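{- Let $\pi$ be a $312$-avoiding permutation and let $P$ and $Q$ be left-to-right maxima of $\pi$ with $P$ lower than $Q$. Then every point of the $\mathrm{nw}$ stripe of $P$ is lower than every point of the $\mathrm{nw}$ stripe of $Q$.
   Context: For $\pi\in S_n$ with plot $\{(i,\pi_i)\}$, $\pi$ avoids $312$ if there are no $a<b<c$ with $\pi_b<\pi_c<\pi_a$. A point is a left-to-right maximum if no point to its left is strictly higher. For a point $(i,\pi_i)$ of a $312$-avoiding $\pi$, $\mathrm{nw}(i,\pi_i)$ is the leftmost left-to-right maximum $(j,\pi_j)$ with $j\leq i$ and $\pi_j\geq\pi_i$. The $\mathrm{nw}$ stripe of a point $p$ is the set $\{q:\mathrm{nw}(q)=\mathrm{nw}(p)\}$. -}

module Defs where

open import Data.Nat using (ℕ)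
open import Data.Fin using (Fin; _<_; _≤_)
open import Data.Product using (_×_; ∃-syntax)
open import Relation.Nullary using (¬_)
open import Function.Bundles using (Bijection)
open import Relation.Binary.PropositionalEquality using (setoid)

-- A permutation of [n] (0-indexed) : a bijection Fin n → Fin n.
-- Its plot is the set of points (i , π i).
Perm : ℕ → Set
Perm n = Bijection (setoid (Fin n)) (setoid (Fin n))

module _ {n : ℕ} (π : Fin n → Fin n) where

  Avoids312 : Set
  Avoids312 = ∀ (a b c : Fin n) → a < b → b < c → ¬ (π b < π c × π c < π a)

  IsLTRMax : Fin n → Set
  IsLTRMax i = ∀ (k : Fin n) → k < i → ¬ (π i < π k)

  -- IsNW i j : (j , π j) = nw(i , π i), i.e. j is the leftmost
  -- left-to-right maximum with j ≤ i and π j ≥ π i.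
  IsNW : Fin n → Fin n → Set
  IsNW i j = IsLTRMax j × j ≤ i × π i ≤ π j
           × (∀ (k : Fin n) → IsLTRMax k → k ≤ i → π i ≤ π k → j ≤ k)

  InNWStripe : Fin n → Fin n → Set
  InNWStripe p q = ∃[ j ] (IsNW p j × IsNW q j)

module Submission where

-- Proof idea.  Write nw(P) = J and nw(Q) = K.
--
--  * a left-to-right maximum b dominates every point weakly to its left;
--    hence J ≤ P gives π J ≤ π P, and contrapositively a point higher than
--    a left-to-right maximum lies strictly to its right;
--  * if the nw points J < K of two stripes are ordered left to right, then
--    the stripe of J lies entirely below the stripe of K: a point q of the
--    stripe of K with π q ≤ π p ≤ π J would make J a candidate for nw(q)
--    (J < K ≤ q), so minimality of K forces K ≤ J, a contradiction.
--
-- The theorem follows: π J ≤ π P < π Q ≤ π K, so J < K by the second half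
-- of the first fact, and the stripe-separation lemma concludes.

open import Defs
open import Data.Nat using (ℕ)
open import Data.Fin using (Fin; _<_; _≤_)
open import Data.Fin.Properties using (toℕ-injective; ≤-reflexive; ≤-trans)
open import Data.Nat.Properties as ℕ using (m≤n⇒m<n∨m≡n; ≮⇒≥; ≰⇒>; <⇒≱; <-≤-trans; ≤-<-trans)
open import Data.Product using (_,_)
open import Data.Sum using (inj₁; inj₂)
open import Function.Bundles using (Bijection)
open import Relation.Binary.PropositionalEquality using (cong)

module _ {n : ℕ} (π : Fin n → Fin n) where

  ltrMax-dominates-left : ∀ {a b : Fin n} → IsLTRMax π b → a ≤ b → π a ≤ π b
  ltrMax-dominates-left {a} {b} maxb a≤b with m≤n⇒m<n∨m≡n a≤b
  ... | inj₁ a<b = ≮⇒≥ (maxb a a<b)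
  ... | inj₂ a≡b = ≤-reflexive (cong π (toℕ-injective a≡b))

  above-ltrMax-is-right : ∀ {a b : Fin n} → IsLTRMax π a → π a < π b → a < b
  above-ltrMax-is-right maxa πa<πb =
    ≰⇒> λ b≤a → <⇒≱ πa<πb (ltrMax-dominates-left maxa b≤a)

  -- Otherwise j would be a left-to-right
  -- maximum weakly left of q and weakly above q, contradicting the
  -- minimality of k as nw(q).
  nw-left-stripe-is-lower : ∀ {p q j k : Fin n} → IsNW π p j → IsNW π q k → j < k
                          → π p < π q
  nw-left-stripe-is-lower (maxj , _ , πp≤πj , _) (_ , k≤q , _ , k-leftmost) j<k =
    ≰⇒> λ πq≤πp →
      <⇒≱ j<k (k-leftmost _ maxj (ℕ.<⇒≤ (<-≤-trans j<k k≤q)) (≤-trans πq≤πp πp≤πj))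

proposition6p6 : ∀ {n : ℕ} (π : Perm n) → Avoids312 (Bijection.to π)
    → ∀ (P Q : Fin n) → IsLTRMax (Bijection.to π) P → IsLTRMax (Bijection.to π) Q
    → Bijection.to π P < Bijection.to π Q
    → ∀ (p q : Fin n) → InNWStripe (Bijection.to π) P p → InNWStripe (Bijection.to π) Q q
    → Bijection.to π p < Bijection.to π q
proposition6p6 π _ P Q maxP _ πP<πQ p q
  (j , (maxj , j≤P , _) , nwp) (k , (_ , _ , πQ≤πk , _) , nwq) =
  nw-left-stripe-is-lower f nwp nwq j<k
  where
  f : Fin _ → Fin _
  f = Bijection.to π

  πj≤πP : f j ≤ f P
  πj≤πP = ltrMax-dominates-left f maxP j≤P

  j<k : j < k
  j<k = above-ltrMax-is-right f maxj (≤-<-trans πj≤πP (<-≤-trans πP<πQ πQ≤πk))
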